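{- Let $p$ be a prime. (i) For every pair of integers $m>n>1$ there exists an integer $i_0=i_0(m,n,p)$ such that for all integers $i\geqslant i_0$, $$\operatorname{div}(\alpha_p(m,n,i))\geqslant\operatorname{div}(\mathbb{W}_{n(i+1)}(\mathbb{F}_p)).$$ (ii) For every pair of integers $m>n>1$, the least integer $i_0(m,n,p)$ with the property in (i) tends to infinity as the prime $p$ tends to infinity. (iii) For every integer $n>1$ there exists an integer $m_0=m_0(n,p)$ such that for all integers $m\geqslant m_0$ and all integers $i>0$, $$\operatorname{div}(\alpha_p(m,n,i))\geqslant\operatorname{div}(\mathbb{W}_{n(i+1)}(\mathbb{F}_p)).$$
   Context: $I_p$ is the set of positive integers not divisible by $p$. Under the canonical ring isomorphism $\mathbb{W}(\mathbb{F}_p)\cong\prod_{j\in I_p}\mathbb{Z}_p$, divisors of non-zero-divisors are identified with vectors in $\prod_{j\in I_p}\mathbb{Z}$ (the $p$-adic valuations of the components), and $\geqslant$ between divisors means componentwise $\geqslant$. Put $s_p(m,i,j)=\operatorname{card}(\{1,\dots,m(i+1)\}\cap\{j,pj,p^2j,\dots\})$. Then $\operatorname{div}(\mathbb{W}_{n(i+1)}(\mathbb{F}_p))$ is the vector $(s_p(n,i,j))_{j\in I_p}$, and $\alpha_p(m,n,i)\in\mathbb{W}(\mathbb{F}_p)$ is an element (determined up to a unit) with $\operatorname{div}(\alpha_p(m,n,i))=\sum_{0\leqslant h<i}\big(\operatorname{div}(\mathbb{W}_{m(h+1)}(\mathbb{F}_p))-\operatorname{div}(\mathbb{W}_{n(h+1)}(\mathbb{F}_p))\big)$,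 i.e. its $j$th component has $p$-adic valuation $\sum_{0\leqslant h<i}(s_p(m,h,j)-s_p(n,h,j))$. -}

module Defs where

open import Data.Nat using (ℕ; zero; suc; _+_; _*_; _^_; _≤_; _<_)
open import Data.Nat.Properties using (_≟_)
open import Data.Nat.Divisibility using (_∣_)
open import Data.Integer as ℤ using (ℤ; +_)
open import Data.List using (List; length; filter; map; upTo)
open import Data.List.Relation.Unary.Any using (any?)
open import Relation.Nullary using (¬_)

-- s_p(m,i,j) = card ({1,…,m(i+1)} ∩ {j, pj, p²j, …}).
-- An element x of {1,…,N} lies in {p^k j : k ≥ 0} iff x = p^k * j for some
-- k ≤ x (for p ≥ 2, j ≥ 1 one has p^k * j > k), so membership is decided
-- by a bounded search over k ∈ {0,…,x}.
inOrbit? : (p j x : ℕ) → _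
inOrbit? p j x = any? (λ k → p ^ k * j ≟ x) (upTo (suc x))

s : (p m i j : ℕ) → ℕ
s p m i j = length (filter (inOrbit? p j) (map suc (upTo (m * suc i))))

divW : (p n i j : ℕ) → ℤ
divW p n i j = + s p n i j

divα : (p m n i j : ℕ) → ℤ
divα p m n zero    j = + 0
divα p m n (suc i) j = divα p m n i j ℤ.+ (+ s p m i j ℤ.- + s p n i j)

InIp : (p j : ℕ) → Set
InIp p j = (1 ≤ j) × (¬ (p ∣ j))
  where open import Data.Product using (_×_)

DivIneq : (p m n i : ℕ) → Set
DivIneq p m n i = ∀ j → InIp p j → divW p n i j ℤ.≤ divα p m n i j

GoodFrom : (p m n i0 : ℕ) → Set
GoodFrom p m n i0 = ∀ i → i0 ≤ i → DivIneq p m n i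

IsLeastGood : (p m n i0 : ℕ) → Set
IsLeastGood p m n i0 = GoodFrom p m n i0 × (∀ k → GoodFrom p m n k → i0 ≤ k)
  where open import Data.Product using (_×_)

-- Write F_j(y) for the number of points of the orbit {j, pj, p²j, …} in [1, y], so that
-- s_p(m,h,j) = F_j(m(h+1)). The inequality at (i, j) says Σ_{h≤i} F_j(n(h+1)) ≤ Σ_{h<i} F_j(m(h+1)).
-- Passing from i to i+1 adds F_j(n(i+2)) on the left and F_j(m(i+1)) on the right. Once
-- n(i+2) ≤ m(i+1), which holds for i+1 ≥ n, or for all i when m ≥ 2n, the right increment is the
-- larger one, and strictly larger when an orbit point lies in (n(i+2), m(i+1)].
-- (i) The initial deficit Σ_{h<n} F_j(n(h+1)) is at most n³, and is zero for j > n². For j ≤ n²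
--     a single large orbit point p^k j lies in (n(i+2), m(i+1)] for n³ consecutive i, paying it off.
-- (ii) For j = 1 and m i < p every term on the right is at most 1 and every term on the left at
--      least 1, so the inequality fails for all i < p / m.
-- (iii) For m ≥ p^{3n}·2n the first step F_j(n) + F_j(2n) ≤ F_j(m) holds; later steps are monotone.
module Submission where

open import Defs
open import Data.Nat
  using (ℕ; zero; suc; _+_; _*_; _^_; _∸_; _≤_; _<_; _≤′_; ≤′-refl; ≤′-step; z≤n; s≤s; z<s;
         NonZero; >-nonZero; >-nonZero⁻¹; nonTrivial⇒n>1)
open import Data.Nat.Properties
open import Data.Nat.DivMod using (_/_; _%_; m≡m%n+[m/n]*n; m%n<n; m/n*n≤m; m/n≤m; m*n/n≡m; /-monoˡ-≤)
open import Data.Nat.Divisibility using (∣1⇒≡1)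
open import Data.Nat.Primality using (Prime; prime⇒nonTrivial)
open import Data.Nat.Tactic.RingSolver using (solve-∀)
open import Data.Integer as ℤ using (+_; +≤+)
open import Data.Integer.Properties using (drop‿+≤+; i≤j⇒0≤j-i; 0≤i-j⇒j≤i)
import Data.Integer.Tactic.RingSolver as ℤ-Solver
open import Data.List using (_++_; [_]; length; filter; map; upTo)
open import Data.List.Properties
  using (upTo-∷ʳ; map-++; filter-++; filter-accept; filter-reject; length-++; length-filter;
         length-map; length-upTo)
open import Data.List.Relation.Unary.Any using (Any; satisfied)
open import Data.List.Membership.Propositional using (lose)
open import Data.List.Membership.Propositional.Properties using (∈-upTo⁺)
open import Data.Product using (_×_; _,_; ∃-syntax)
open import Function using (_∘_)
open import Function.Bundles using (_⇔_; mk⇔; Equivalence)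
open import Relation.Nullary using (¬_; Dec; yes; no)
open import Relation.Binary.PropositionalEquality using (_≡_; refl; sym; trans; cong; cong₂; subst)
open ≤-Reasoning

sumBelow : (ℕ → ℕ) → ℕ → ℕ
sumBelow f zero    = 0
sumBelow f (suc i) = sumBelow f i + f i

sumBelow-mono-≤ : ∀ {f g : ℕ → ℕ} i → (∀ h → h < i → f h ≤ g h) → sumBelow f i ≤ sumBelow g i
sumBelow-mono-≤ zero    f≤g = z≤n
sumBelow-mono-≤ (suc i) f≤g =
  +-mono-≤ (sumBelow-mono-≤ i (λ h h<i → f≤g h (m<n⇒m<1+n h<i))) (f≤g i ≤-refl)

sumBelow-const : ∀ c i → sumBelow (λ _ → c) i ≡ i * c
sumBelow-const c zero    = refl
sumBelow-const c (suc i) = trans (cong (_+ c) (sumBelow-const c i)) (+-comm (i * c) c)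

absorb-slack : ∀ {x u v e} y k → x ≤ y + (e + k) → e + u ≤ v → x + u ≤ y + v + k
absorb-slack {x} {u} {v} {e} y k x≤ e+u≤v = begin
  x + u           ≤⟨ +-monoˡ-≤ u x≤ ⟩
  y + (e + k) + u ≡⟨ regroup y e k u ⟩
  y + k + (e + u) ≤⟨ +-monoʳ-≤ (y + k) e+u≤v ⟩
  y + k + v       ≡⟨ swap y k v ⟩
  y + v + k       ∎
  where
  regroup : ∀ y e k u → y + (e + k) + u ≡ y + k + (e + u)
  regroup = solve-∀
  swap : ∀ y k v → y + k + v ≡ y + v + k
  swap = solve-∀

sumBelow-gap-closes : ∀ {f g : ℕ → ℕ} e K a d →
  (∀ t → t < d → e + f (suc (t + a)) ≤ g (t + a)) →
  sumBelow f (suc a) ≤ sumBelow g a + (e * d + K) →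
  sumBelow f (suc (d + a)) ≤ sumBelow g (d + a) + K
sumBelow-gap-closes {f} {g} e K a zero    step base =
  subst (λ z → sumBelow f (suc a) ≤ sumBelow g a + (z + K)) (*-zeroʳ e) base
sumBelow-gap-closes {f} {g} e K a (suc d) step base =
  absorb-slack (sumBelow g (d + a)) K
    (sumBelow-gap-closes e (e + K) a d (λ t t<d → step t (m<n⇒m<1+n t<d)) base′)
    (step d ≤-refl)
  where
  base′ : sumBelow f (suc a) ≤ sumBelow g a + (e * d + (e + K))
  base′ = subst (λ z → sumBelow f (suc a) ≤ sumBelow g a + z) (slack e d K) base
    where
    slack : ∀ e d K → e * suc d + K ≡ e * d + (e + K)
    slack = solve-∀

sumBelow-gap-persists : ∀ {f g : ℕ → ℕ} {K a b} → a ≤ b →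
  (∀ h → a ≤ h → h < b → f (suc h) ≤ g h) →
  sumBelow f (suc a) ≤ sumBelow g a + K →
  sumBelow f (suc b) ≤ sumBelow g b + K
sumBelow-gap-persists {f} {g} {K} {a} {b} a≤b step base =
  subst (λ c → sumBelow f (suc c) ≤ sumBelow g c + K) d+a≡b
        (sumBelow-gap-closes 0 K a d step′ base)
  where
  d : ℕ
  d = b ∸ a
  d+a≡b : d + a ≡ b
  d+a≡b = m∸n+n≡m a≤b
  step′ : ∀ t → t < d → f (suc (t + a)) ≤ g (t + a)
  step′ t t<d = step (t + a) (m≤n+m a t) (subst (t + a <_) d+a≡b (+-monoˡ-< a t<d))

InOrbit : ℕ → ℕ → ℕ → Set
InOrbit p j x = Any (λ k → p ^ k * j ≡ x) (upTo (suc x))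

orbitCount : ℕ → ℕ → ℕ → ℕ
orbitCount p j y = length (filter (inOrbit? p j) (map suc (upTo y)))

orbitCount-suc : ∀ p j y →
  orbitCount p j (suc y) ≡ orbitCount p j y + length (filter (inOrbit? p j) [ suc y ])
orbitCount-suc p j y = begin-equality
  length (filter P? (map suc (upTo (suc y))))
    ≡⟨ cong (length ∘ filter P? ∘ map suc) (upTo-∷ʳ y) ⟨
  length (filter P? (map suc (upTo y ++ [ y ])))
    ≡⟨ cong (length ∘ filter P?) (map-++ suc (upTo y) [ y ]) ⟩
  length (filter P? (map suc (upTo y) ++ [ suc y ]))
    ≡⟨ cong length (filter-++ P? (map suc (upTo y)) [ suc y ]) ⟩
  length (filter P? (map suc (upTo y)) ++ filter P? [ suc y ])
    ≡⟨ length-++ (filter P? (map suc (upTo y))) ⟩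
  orbitCount p j y + length (filter P? [ suc y ]) ∎
  where
  P? : ∀ x → Dec (InOrbit p j x)
  P? = inOrbit? p j

orbitCount-suc-∈ : ∀ {p j y} → InOrbit p j (suc y) → orbitCount p j (suc y) ≡ suc (orbitCount p j y)
orbitCount-suc-∈ {p} {j} {y} x∈ = begin-equality
  orbitCount p j (suc y)     ≡⟨ orbitCount-suc p j y ⟩
  orbitCount p j y + length (filter (inOrbit? p j) [ suc y ])
                             ≡⟨ cong (λ l → orbitCount p j y + length l) (filter-accept (inOrbit? p j) x∈) ⟩
  orbitCount p j y + 1       ≡⟨ +-comm (orbitCount p j y) 1 ⟩
  suc (orbitCount p j y)     ∎

orbitCount-suc-∉ : ∀ {p j y} → ¬ InOrbit p j (suc y) → orbitCount p j (suc y) ≡ orbitCount p j y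
orbitCount-suc-∉ {p} {j} {y} x∉ = begin-equality
  orbitCount p j (suc y)     ≡⟨ orbitCount-suc p j y ⟩
  orbitCount p j y + length (filter (inOrbit? p j) [ suc y ])
                             ≡⟨ cong (λ l → orbitCount p j y + length l) (filter-reject (inOrbit? p j) x∉) ⟩
  orbitCount p j y + 0       ≡⟨ +-identityʳ (orbitCount p j y) ⟩
  orbitCount p j y           ∎

orbitCount-mono-≤ : ∀ {p j y z} → y ≤ z → orbitCount p j y ≤ orbitCount p j z
orbitCount-mono-≤ {p} {j} y≤z = go (≤⇒≤′ y≤z)
  where
  go : ∀ {y z} → y ≤′ z → orbitCount p j y ≤ orbitCount p j z
  go ≤′-refl                = ≤-refl
  go (≤′-step {z} y≤′z) = ≤-trans (go y≤′z)
    (≤-trans (m≤m+n (orbitCount p j z) _) (≤-reflexive (sym (orbitCount-suc p j z))))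

orbitCount-≤ : ∀ p j y → orbitCount p j y ≤ y
orbitCount-≤ p j y = begin
  orbitCount p j y           ≤⟨ length-filter (inOrbit? p j) (map suc (upTo y)) ⟩
  length (map suc (upTo y))  ≡⟨ length-map suc (upTo y) ⟩
  length (upTo y)            ≡⟨ length-upTo y ⟩
  y                          ∎

inOrbit⇒orbitCount-< : ∀ {p j x y z} → InOrbit p j x → y < x → x ≤ z →
  orbitCount p j y < orbitCount p j z
inOrbit⇒orbitCount-< {p} {j} {suc x} {y} {z} x∈ (s≤s y≤x) x≤z = begin-strict
  orbitCount p j y             ≤⟨ orbitCount-mono-≤ y≤x ⟩
  orbitCount p j x             <⟨ n<1+n (orbitCount p j x) ⟩
  suc (orbitCount p j x)       ≡⟨ orbitCount-suc-∈ x∈ ⟨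
  orbitCount p j (suc x)       ≤⟨ orbitCount-mono-≤ x≤z ⟩
  orbitCount p j z             ∎

module _ {p : ℕ} (1<p : 1 < p) where

  private instance
    p≢0 : NonZero p
    p≢0 = >-nonZero (<-trans z<s 1<p)

  k<p^k : ∀ k → k < p ^ k
  k<p^k zero    = z<s
  k<p^k (suc k) = begin-strict
    suc k         ≤⟨ k<p^k k ⟩
    p ^ k         <⟨ m<m*n (p ^ k) p {{m^n≢0 p k}} 1<p ⟩
    p ^ k * p     ≡⟨ *-comm (p ^ k) p ⟩
    p ^ suc k     ∎

  pow*-inOrbit : ∀ {j} .{{_ : NonZero j}} k → InOrbit p j (p ^ k * j)
  pow*-inOrbit {j} k = lose (∈-upTo⁺ (s≤s (<⇒≤ (<-≤-trans (k<p^k k) (m≤m*n (p ^ k) j))))) refl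

  y<j⇒orbitCount≡0 : ∀ {j y} → y < j → orbitCount p j y ≡ 0
  y<j⇒orbitCount≡0 {j} {zero}  _   = refl
  y<j⇒orbitCount≡0 {j} {suc y} y<j =
    trans (orbitCount-suc-∉ ∉) (y<j⇒orbitCount≡0 (<-trans (n<1+n y) y<j))
    where
    ∉ : ¬ InOrbit p j (suc y)
    ∉ x∈ with satisfied x∈
    ... | k , pᵏj≡x = <⇒≱ y<j (≤-trans (m≤n*m j (p ^ k) {{m^n≢0 p k}}) (≤-reflexive pᵏj≡x))

  pow*≤⇒orbitCount> : ∀ {j y} .{{_ : NonZero j}} c → p ^ c * j ≤ y → c < orbitCount p j y
  pow*≤⇒orbitCount> {j} zero    pᶜj≤y =
    inOrbit⇒orbitCount-< (pow*-inOrbit 0) (>-nonZero⁻¹ (1 * j) {{m*n≢0 1 j}}) pᶜj≤y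
  pow*≤⇒orbitCount> {j} (suc c) pᶜj≤y = ≤-<-trans
    (pow*≤⇒orbitCount> c ≤-refl)
    (inOrbit⇒orbitCount-< (pow*-inOrbit (suc c)) (*-monoˡ-< j (^-monoʳ-< p 1<p (n<1+n c))) pᶜj≤y)

  y<p⇒orbitCount[1]≤1 : ∀ {y} → y < p → orbitCount p 1 y ≤ 1
  y<p⇒orbitCount[1]≤1 {zero}        _   = z≤n
  y<p⇒orbitCount[1]≤1 {suc zero}    _   = orbitCount-≤ p 1 1
  y<p⇒orbitCount[1]≤1 {suc (suc y)} y<p =
    ≤-trans (≤-reflexive (orbitCount-suc-∉ ∉)) (y<p⇒orbitCount[1]≤1 (<-trans (n<1+n (suc y)) y<p))
    where
    ∉ : ¬ InOrbit p 1 (suc (suc y))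
    ∉ x∈ with satisfied x∈
    ... | suc k , pᵏ≡x =
      <⇒≱ y<p (≤-trans (≤-trans (m≤m*n p (p ^ k) {{m^n≢0 p k}}) (m≤m*n (p ^ suc k) 1)) (≤-reflexive pᵏ≡x))

divα≡ : ∀ p m n i j →
  divα p m n i j ≡ + sumBelow (λ h → s p m h j) i ℤ.- + sumBelow (λ h → s p n h j) i
divα≡ p m n zero    j = refl
divα≡ p m n (suc i) j =
  trans (cong (ℤ._+ (+ s p m i j ℤ.- + s p n i j)) (divα≡ p m n i j))
        (regroup (+ sumBelow (λ h → s p m h j) i) (+ sumBelow (λ h → s p n h j) i)
                 (+ s p m i j) (+ s p n i j))
  where
  regroup : ∀ a b c d → (a ℤ.- b) ℤ.+ (c ℤ.- d) ≡ (a ℤ.+ c) ℤ.- (b ℤ.+ d)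
  regroup = ℤ-Solver.solve-∀

m≤n-o⇔o+m≤n : ∀ m n o → + m ℤ.≤ + n ℤ.- + o ⇔ o + m ≤ n
m≤n-o⇔o+m≤n m n o = mk⇔
  (λ m≤n-o → drop‿+≤+ (0≤i-j⇒j≤i (subst (ℤ._≤_ (+ 0)) n-o-m≡n-[o+m] (i≤j⇒0≤j-i m≤n-o))))
  (λ o+m≤n → 0≤i-j⇒j≤i (subst (ℤ._≤_ (+ 0)) (sym n-o-m≡n-[o+m]) (i≤j⇒0≤j-i (+≤+ o+m≤n))))
  where
  regroup : ∀ a b c → (a ℤ.- b) ℤ.- c ≡ a ℤ.- (b ℤ.+ c)
  regroup = ℤ-Solver.solve-∀
  n-o-m≡n-[o+m] : + n ℤ.- + o ℤ.- + m ≡ + n ℤ.- (+ o ℤ.+ + m)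
  n-o-m≡n-[o+m] = regroup (+ n) (+ o) (+ m)

divW≤divα⇔ : ∀ p m n i j →
  divW p n i j ℤ.≤ divα p m n i j ⇔ sumBelow (λ h → s p n h j) (suc i) ≤ sumBelow (λ h → s p m h j) i
divW≤divα⇔ p m n i j rewrite divα≡ p m n i j =
  m≤n-o⇔o+m≤n (s p n i j) (sumBelow (λ h → s p m h j) i) (sumBelow (λ h → s p n h j) i)

prime>1 : ∀ {p} → Prime p → 1 < p
prime>1 {p} p-prime = nonTrivial⇒n>1 p {{prime⇒nonTrivial p-prime}}

DivIneq-intro : ∀ {p m n i} →
  (∀ {j} → 1 ≤ j → sumBelow (λ h → s p n h j) (suc i) ≤ sumBelow (λ h → s p m h j) i) →
  DivIneq p m n i
DivIneq-intro {p} {m} {n} {i} ineq j (1≤j , _) = Equivalence.from (divW≤divα⇔ p m n i j) (ineq 1≤j)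

m<[1+m/n]*n : ∀ m n .{{_ : NonZero n}} → m < suc (m / n) * n
m<[1+m/n]*n m n = begin-strict
  m                  ≡⟨ m≡m%n+[m/n]*n m n ⟩
  m % n + m / n * n  <⟨ +-monoˡ-< (m / n * n) (m%n<n m n) ⟩
  n + m / n * n      ∎

n<m⇒n[2+h]≤m[1+h] : ∀ {m n} h → n < m → n ≤ suc h → n * suc (suc h) ≤ m * suc h
n<m⇒n[2+h]≤m[1+h] {m} {n} h n<m n≤1+h = begin
  n * suc (suc h)    ≡⟨ *-suc n (suc h) ⟩
  n + n * suc h      ≤⟨ +-monoˡ-≤ (n * suc h) n≤1+h ⟩
  suc n * suc h      ≤⟨ *-monoˡ-≤ (suc h) n<m ⟩
  m * suc h          ∎

n*2≤m⇒n[2+h]≤m[1+h] : ∀ {m n} h → n * 2 ≤ m → n * suc (suc h) ≤ m * suc h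
n*2≤m⇒n[2+h]≤m[1+h] {m} {n} h n*2≤m = begin
  n * suc (suc h)          ≡⟨ *-suc n (suc h) ⟩
  n + n * suc h            ≤⟨ +-monoˡ-≤ (n * suc h) (m≤m*n n (suc h)) ⟩
  n * suc h + n * suc h    ≡⟨ double n h ⟩
  n * 2 * suc h            ≤⟨ *-monoˡ-≤ (suc h) n*2≤m ⟩
  m * suc h                ∎
  where
  double : ∀ n h → n * suc h + n * suc h ≡ n * 2 * suc h
  double = solve-∀

sumBelow-s≤ : ∀ p n j → sumBelow (λ h → s p n h j) n ≤ n * orbitCount p j (n * n)
sumBelow-s≤ p n j = begin
  sumBelow (λ h → s p n h j) n
    ≤⟨ sumBelow-mono-≤ n (λ h h<n → orbitCount-mono-≤ (*-monoʳ-≤ n h<n)) ⟩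
  sumBelow (λ _ → orbitCount p j (n * n)) n
    ≡⟨ sumBelow-const (orbitCount p j (n * n)) n ⟩
  n * orbitCount p j (n * n)                ∎

module PartI {p m n-1 : ℕ} (1<p : 1 < p) (n<m : suc n-1 < m) where
  n K L k : ℕ
  n = suc n-1
  K = n * (n * n)
  L = suc (n * suc K)
  k = L * m

  private instance
    m≢0 : NonZero m
    m≢0 = >-nonZero (<-trans z<s n<m)

  -- K bounds the initial deficit when j ≤ n * n; k = L * m forces w j ≥ L, which puts the orbit
  -- point p ^ k * j inside (n (h + 2), m (h + 1)] for every h in [w j, w j + K).
  w : ℕ → ℕ
  w j = p ^ k * j / m

  L≤w : ∀ j .{{_ : NonZero j}} → L ≤ w j
  L≤w j = begin
    L              ≡⟨ m*n/n≡m L m ⟨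
    L * m / m      ≤⟨ /-monoˡ-≤ m (<⇒≤ (<-≤-trans (k<p^k 1<p k) (m≤m*n (p ^ k) j))) ⟩
    p ^ k * j / m  ∎

  n-1≤w : ∀ j .{{_ : NonZero j}} → n-1 ≤ w j
  n-1≤w j = ≤-trans (n≤1+n n-1) (≤-trans (m≤m*n n (suc K)) (≤-trans (n≤1+n _) (L≤w j)))

  window-jump : ∀ j .{{_ : NonZero j}} t → t < K → suc (s p n (suc (t + w j)) j) ≤ s p m (t + w j) j
  window-jump j t t<K = inOrbit⇒orbitCount-< (pow*-inOrbit 1<p k) below above
    where
    below : n * suc (suc (t + w j)) < p ^ k * j
    below = begin-strict
      n * (suc (suc t) + w j)  ≤⟨ *-monoʳ-≤ n (+-monoˡ-≤ (w j) (s≤s t<K)) ⟩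
      n * (suc K + w j)        ≡⟨ *-distribˡ-+ n (suc K) (w j) ⟩
      n * suc K + n * w j      <⟨ +-monoˡ-< (n * w j) (L≤w j) ⟩
      suc n * w j              ≤⟨ *-monoˡ-≤ (w j) n<m ⟩
      m * w j                  ≡⟨ *-comm m (w j) ⟩
      w j * m                  ≤⟨ m/n*n≤m (p ^ k * j) m ⟩
      p ^ k * j                ∎
    above : p ^ k * j ≤ m * suc (t + w j)
    above = begin
      p ^ k * j            ≤⟨ <⇒≤ (m<[1+m/n]*n (p ^ k * j) m) ⟩
      suc (w j) * m        ≡⟨ *-comm (suc (w j)) m ⟩
      m * suc (w j)        ≤⟨ *-monoʳ-≤ m (s≤s (m≤n+m (w j) t)) ⟩
      m * suc (t + w j)    ∎

  mono-step : ∀ {j a b} → n-1 ≤ a → ∀ h → a ≤ h → h < b → s p n (suc h) j ≤ s p m h j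
  mono-step n-1≤a h a≤h _ = orbitCount-mono-≤ (n<m⇒n[2+h]≤m[1+h] h n<m (s≤s (≤-trans n-1≤a a≤h)))

  initial-gap : ∀ j →
    sumBelow (λ h → s p n h j) n ≤ sumBelow (λ h → s p m h j) n-1 + n * orbitCount p j (n * n)
  initial-gap j = ≤-trans (sumBelow-s≤ p n j) (m≤n+m _ (sumBelow (λ h → s p m h j) n-1))

  i₀ : ℕ
  i₀ = K + p ^ k * (n * n)

  sumBelow-≤-j≤n² : ∀ {i j} .{{_ : NonZero j}} → j ≤ n * n → i₀ ≤ i →
    sumBelow (λ h → s p n h j) (suc i) ≤ sumBelow (λ h → s p m h j) i + 0
  sumBelow-≤-j≤n² {i} {j} j≤n² i₀≤i =
    sumBelow-gap-persists K+w≤i (mono-step (≤-trans (n-1≤w j) (m≤n+m (w j) K))) after-window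
    where
    before-window : sumBelow (λ h → s p n h j) (suc (w j)) ≤ sumBelow (λ h → s p m h j) (w j) + K
    before-window = sumBelow-gap-persists (n-1≤w j) (mono-step ≤-refl)
      (≤-trans (initial-gap j) (+-monoʳ-≤ _ (*-monoʳ-≤ n (orbitCount-≤ p j (n * n)))))
    after-window : sumBelow (λ h → s p n h j) (suc (K + w j)) ≤ sumBelow (λ h → s p m h j) (K + w j) + 0
    after-window = sumBelow-gap-closes 1 0 (w j) K (window-jump j)
      (subst (λ z → sumBelow (λ h → s p n h j) (suc (w j)) ≤ sumBelow (λ h → s p m h j) (w j) + z)
             (sym (trans (+-identityʳ (1 * K)) (*-identityˡ K))) before-window)
    K+w≤i : K + w j ≤ i
    K+w≤i = ≤-trans (+-monoʳ-≤ K (≤-trans (m/n≤m (p ^ k * j) m) (*-monoʳ-≤ (p ^ k) j≤n²))) i₀≤i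

  sumBelow-≤-j>n² : ∀ {i j} → n * n < j → n-1 ≤ i →
    sumBelow (λ h → s p n h j) (suc i) ≤ sumBelow (λ h → s p m h j) i + 0
  sumBelow-≤-j>n² {i} {j} n²<j n-1≤i = sumBelow-gap-persists n-1≤i (mono-step ≤-refl)
    (subst (λ z → sumBelow (λ h → s p n h j) n ≤ sumBelow (λ h → s p m h j) n-1 + z) no-deficit
           (initial-gap j))
    where
    no-deficit : n * orbitCount p j (n * n) ≡ 0
    no-deficit = trans (cong (n *_) (y<j⇒orbitCount≡0 1<p n²<j)) (*-zeroʳ n)

  sumBelow-≤ : ∀ {i j} → 1 ≤ j → i₀ ≤ i →
    sumBelow (λ h → s p n h j) (suc i) ≤ sumBelow (λ h → s p m h j) i
  sumBelow-≤ {i} {j} 1≤j i₀≤i = ≤-trans gap-closed (≤-reflexive (+-identityʳ _))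
    where
    gap-closed : sumBelow (λ h → s p n h j) (suc i) ≤ sumBelow (λ h → s p m h j) i + 0
    gap-closed with j ≤? n * n
    ... | yes j≤n² = sumBelow-≤-j≤n² {{>-nonZero 1≤j}} j≤n² i₀≤i
    ... | no j≰n² = sumBelow-≤-j>n² (≰⇒> j≰n²)
      (≤-trans (n≤1+n n-1) (≤-trans (m≤m*n n (n * n)) (≤-trans (m≤m+n K _) i₀≤i)))

DivIneq-eventually : ∀ {p} → 1 < p → ∀ m n → 0 < n → n < m → ∃[ i₀ ] GoodFrom p m n i₀
DivIneq-eventually {p} 1<p m (suc n-1) _ n<m = PartI.i₀ 1<p n<m , λ i i₀≤i →
  DivIneq-intro {p} {m} {suc n-1} {i} (λ 1≤j → PartI.sumBelow-≤ 1<p n<m 1≤j i₀≤i)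

¬DivIneq-below : ∀ {p m n i} .{{_ : NonZero n}} → 1 < p → m * i < p → ¬ DivIneq p m n i
¬DivIneq-below {p} {m} {n} {i} 1<p m*i<p ineq = n≮n (i * 1) (begin-strict
  i * 1                            <⟨ n<1+n (i * 1) ⟩
  suc i * 1                        ≡⟨ sumBelow-const 1 (suc i) ⟨
  sumBelow (λ _ → 1) (suc i)       ≤⟨ sumBelow-mono-≤ (suc i) (λ h _ → orbit-nonempty h) ⟩
  sumBelow (λ h → s p n h 1) (suc i)
                                   ≤⟨ Equivalence.to (divW≤divα⇔ p m n i 1) (ineq 1 1∈Iₚ) ⟩
  sumBelow (λ h → s p m h 1) i     ≤⟨ sumBelow-mono-≤ i (λ _ h<i → y<p⇒orbitCount[1]≤1 1<p (below-p h<i)) ⟩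
  sumBelow (λ _ → 1) i             ≡⟨ sumBelow-const 1 i ⟩
  i * 1                            ∎)
  where
  1∈Iₚ : InIp p 1
  1∈Iₚ = ≤-refl , λ p∣1 → <⇒≢ 1<p (sym (∣1⇒≡1 p∣1))
  orbit-nonempty : ∀ h → 1 ≤ s p n h 1
  orbit-nonempty h = pow*≤⇒orbitCount> 1<p 0 (>-nonZero⁻¹ (n * suc h) {{m*n≢0 n (suc h)}})
  below-p : ∀ {h} → h < i → m * suc h < p
  below-p h<i = ≤-<-trans (*-monoʳ-≤ m h<i) m*i<p

leastGood-unbounded : ∀ m n → 0 < n → ∀ B → ∃[ P₀ ] (∀ p → Prime p → P₀ ≤ p →
  ∀ i₀ → IsLeastGood p m n i₀ → B ≤ i₀)
leastGood-unbounded m n 0<n B = suc (m * B) , λ p p-prime P₀≤p i₀ (good , _) →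
  ≮⇒≥ λ i₀<B → ¬DivIneq-below {{>-nonZero 0<n}} (prime>1 p-prime)
                 (<-≤-trans (s≤s (*-monoʳ-≤ m (<⇒≤ i₀<B))) P₀≤p) (good i₀ ≤-refl)

module PartIII {p : ℕ} (1<p : 1 < p) (n : ℕ) where
  c m₀ : ℕ
  c = n * 1 + n * 2
  m₀ = p ^ c * (n * 2)

  first-step : ∀ {m j} → m₀ ≤ m → 1 ≤ j → s p n 0 j + s p n 1 j ≤ s p m 0 j + 0
  first-step {m} {j} m₀≤m 1≤j with j ≤? n * 2
  ... | yes j≤n*2 = begin
    s p n 0 j + s p n 1 j  ≤⟨ +-mono-≤ (orbitCount-≤ p j (n * 1)) (orbitCount-≤ p j (n * 2)) ⟩
    c                      ≤⟨ <⇒≤ (pow*≤⇒orbitCount> 1<p c pᶜj≤m) ⟩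
    s p m 0 j              ≤⟨ m≤m+n (s p m 0 j) 0 ⟩
    s p m 0 j + 0          ∎
    where
    instance
      j≢0 : NonZero j
      j≢0 = >-nonZero 1≤j
    pᶜj≤m : p ^ c * j ≤ m * 1
    pᶜj≤m = ≤-trans (*-monoʳ-≤ (p ^ c) j≤n*2) (≤-trans m₀≤m (≤-reflexive (sym (*-identityʳ m))))
  ... | no j≰n*2 = begin
    s p n 0 j + s p n 1 j  ≡⟨ cong₂ _+_ (y<j⇒orbitCount≡0 1<p n*1<j) (y<j⇒orbitCount≡0 1<p n*2<j) ⟩
    0                      ≤⟨ z≤n ⟩
    s p m 0 j + 0          ∎
    where
    n*2<j : n * 2 < j
    n*2<j = ≰⇒> j≰n*2
    n*1<j : n * 1 < j
    n*1<j = ≤-<-trans (*-monoʳ-≤ n (s≤s z≤n)) n*2<j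

  sumBelow-≤ : ∀ {m i j} → m₀ ≤ m → 1 ≤ j →
    sumBelow (λ h → s p n h j) (suc (suc i)) ≤ sumBelow (λ h → s p m h j) (suc i)
  sumBelow-≤ {m} {i} {j} m₀≤m 1≤j = ≤-trans
    (sumBelow-gap-persists (s≤s z≤n) mono-step (first-step m₀≤m 1≤j))
    (≤-reflexive (+-identityʳ _))
    where
    instance
      pᶜ≢0 : NonZero (p ^ c)
      pᶜ≢0 = >-nonZero (≤-<-trans z≤n (k<p^k 1<p c))
    n*2≤m : n * 2 ≤ m
    n*2≤m = ≤-trans (m≤n*m (n * 2) (p ^ c)) m₀≤m
    mono-step : ∀ h → 1 ≤ h → h < suc i → s p n (suc h) j ≤ s p m h j
    mono-step h _ _ = orbitCount-mono-≤ (n*2≤m⇒n[2+h]≤m[1+h] {m} {n} h n*2≤m)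

DivIneq-for-large-m : ∀ {p} → 1 < p → ∀ n → ∃[ m₀ ] (∀ m → m₀ ≤ m → ∀ i → 0 < i → DivIneq p m n i)
DivIneq-for-large-m {p} 1<p n = PartIII.m₀ 1<p n , λ where
  m m₀≤m (suc i) _ → DivIneq-intro {p} {m} {n} {suc i} (PartIII.sumBelow-≤ 1<p n m₀≤m)

theorem6p3 :
    -- (i)
    (∀ p → Prime p → ∀ m n → 1 < n → n < m →
      ∃[ i0 ] GoodFrom p m n i0)
    ×
    -- (ii): least i0(m,n,p) → ∞ as p → ∞
    (∀ m n → 1 < n → n < m → ∀ B → ∃[ P0 ] (∀ p → Prime p → P0 ≤ p →
      ∀ i0 → IsLeastGood p m n i0 → B ≤ i0))
    ×
    -- (iii)
    (∀ p → Prime p → ∀ n → 1 < n →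
      ∃[ m0 ] (∀ m → m0 ≤ m → ∀ i → 0 < i → DivIneq p m n i))
theorem6p3 =
    (λ p p-prime m n 1<n → DivIneq-eventually (prime>1 p-prime) m n (<-trans z<s 1<n))
  , (λ m n 1<n _ → leastGood-unbounded m n (<-trans z<s 1<n))
  , (λ p p-prime n _ → DivIneq-for-large-m (prime>1 p-prime) n)
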